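{- For every integer $n\geq 2$, $\Gamma_b(P_n)=I\!R_b(P_n)=\operatorname{diam}(P_n)=n-1$, where $P_n$ is the path of order $n$.
   Context: All graphs are finite, simple and connected; $d_G(u,v)$ is the distance, $e_G(v)$ the eccentricity of $v$, $\operatorname{diam}(G)$ the diameter. A broadcast on $G=(V,E)$ is a function $f:V\to\{0,\dots,\operatorname{diam}(G)\}$ with $f(v)\le e_G(v)$ for all $v$. Let $V^+_f=\{v: f(v)>0\}$. A vertex $u$ hears $v$ (and $v$ $f$-dominates $u$) if $v\in V^+_f$ and $d_G(u,v)\le f(v)$. Let $H_f(u)=\{v\in V^+_f: d_G(u,v)\le f(v)\}$. For $v\in V^+_f$, $PN_f(v)=\{u\in V: H_f(u)=\{v\}\}$, and the private border $PB_f(v)$ is $\{v\}$ if $f(v)=1$ and $PN_f(v)=\{v\}$, and otherwise $PB_f(v)=\{u\in PN_f(v): d_G(u,v)=f(v)\}$. The cost of $f$ is $\sigma(f)=\sum_{v\in V}f(v)$. A broadcast of some type is minimal if no other broadcast $g\ne f$ of the same type satisfies $g(u)\le f(u)$ for all $u$. A broadcast $f$ is dominating if $|H_f(u)|\ge 1$ for every $u\in V$; $\Gamma_b(G)$ is the maximum cost of a minimal dominating broadcast on $G$. A broadcast $f$ is irredundant if $PB_f(v)\neq\emptyset$ for every $v\in V^+_f$; $I\!R_b(G)$ is the maximum cost of an irredundant broadcast on $G$. -}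

module Defs where

open import Data.Nat using (ℕ; zero; suc; _≤_; _<_; _⊔_; ∣_-_∣)
open import Data.Fin using (Fin; toℕ)
open import Data.List using (List; map; foldr; allFin)
open import Data.Nat.ListAction using (sum)
open import Data.Product using (Σ; ∃; _×_)
open import Data.Sum using (_⊎_)
open import Relation.Nullary using (¬_)
open import Relation.Binary.PropositionalEquality using (_≡_)

-- A finite connected graph on vertex set Fin n is represented here only
-- through its distance function d_G : Fin n → Fin n → ℕ (all notions below
-- depend on G only through d_G).
Dist : ℕ → Set
Dist n = Fin n → Fin n → ℕ

-- The path P_n : vertices 0,…,n-1, edges {i, i+1}.  Its graph distance is
-- d(i,j) = |i - j|.
pathDist : (n : ℕ) → Dist n
pathDist n i j = ∣ toℕ i - toℕ j ∣

maxList : List ℕ → ℕ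
maxList = foldr _⊔_ 0

ecc : {n : ℕ} → Dist n → Fin n → ℕ
ecc {n} d v = maxList (map (d v) (allFin n))

diam : {n : ℕ} → Dist n → ℕ
diam {n} d = maxList (map (ecc d) (allFin n))

IsBroadcast : {n : ℕ} → Dist n → (Fin n → ℕ) → Set
IsBroadcast d f = ∀ v → f v ≤ ecc d v

cost : {n : ℕ} → (Fin n → ℕ) → ℕ
cost {n} f = sum (map f (allFin n))

Hears : {n : ℕ} → Dist n → (Fin n → ℕ) → Fin n → Fin n → Set
Hears d f u v = (0 < f v) × (d u v ≤ f v)

IsDominating : {n : ℕ} → Dist n → (Fin n → ℕ) → Set
IsDominating d f = ∀ u → ∃ λ v → Hears d f u v

IsDomBroadcast : {n : ℕ} → Dist n → (Fin n → ℕ) → Set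
IsDomBroadcast d f = IsBroadcast d f × IsDominating d f

IsMinimalDom : {n : ℕ} → Dist n → (Fin n → ℕ) → Set
IsMinimalDom {n} d f =
  IsDomBroadcast d f ×
  (∀ (g : Fin n → ℕ) → IsDomBroadcast d g → (∀ u → g u ≤ f u) → ∀ u → g u ≡ f u)

InPN : {n : ℕ} → Dist n → (Fin n → ℕ) → Fin n → Fin n → Set
InPN d f v u = Hears d f u v × (∀ w → Hears d f u w → w ≡ v)

PBSpecial : {n : ℕ} → Dist n → (Fin n → ℕ) → Fin n → Set
PBSpecial d f v = (f v ≡ 1) × (∀ u → (InPN d f v u → u ≡ v) × (u ≡ v → InPN d f v u))

InPB : {n : ℕ} → Dist n → (Fin n → ℕ) → Fin n → Fin n → Set
InPB d f v u =
  (PBSpecial d f v × u ≡ v) ⊎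
  (¬ PBSpecial d f v × InPN d f v u × d u v ≡ f v)

IsIrredundant : {n : ℕ} → Dist n → (Fin n → ℕ) → Set
IsIrredundant d f = IsBroadcast d f × (∀ v → 0 < f v → ∃ λ u → InPB d f v u)

IsMaxCost : {n : ℕ} → ((Fin n → ℕ) → Set) → ℕ → Set
IsMaxCost {n} P k = (∃ λ f → P f × cost f ≡ k) × (∀ f → P f → cost f ≤ k)

UpperBroadcastDom : {n : ℕ} → Dist n → ℕ → Set
UpperBroadcastDom d k = IsMaxCost (IsMinimalDom d) k

UpperBroadcastIrr : {n : ℕ} → Dist n → ℕ → Set
UpperBroadcastIrr d k = IsMaxCost (IsIrredundant d) k

-- The broadcast of strength n - 1 from an end vertex is minimal dominating and irredundant.
-- Conversely, in a minimal dominating broadcast (lowering f v by one leaves some vertex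
-- undominated) and in an irredundant one, every broadcasting vertex v has a private neighbour u
-- at distance exactly f v, or f v = 1 and u = v.  Charge to v the f v edges of the subpath
-- from u to v (an edge at v in the degenerate case).  No edge is charged twice: if x lies
-- on both subpaths, then by the triangle inequality through x one of the two private
-- neighbours hears the other broadcasting vertex.  So the cost is at most the number of edges,
-- n - 1, which is also the diameter.
module Submission where

open import Defs
open import Data.Nat using (ℕ; _≤_; _∸_)
open import Data.Product using (_×_)
open import Relation.Binary.PropositionalEquality using (_≡_)

open import Data.Empty using (⊥; ⊥-elim)
open import Data.Fin using (Fin; zero; suc; toℕ; fromℕ; inject₁)
open import Data.Fin.Properties using (toℕ-inject₁; toℕ-fromℕ; toℕ≤pred[n]; any?; ¬∀⟶∃¬)
import Data.Fin.Properties as Fin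
open import Data.List using (map; tabulate; allFin)
import Data.List as List
open import Data.Nat
  using (zero; suc; pred; _+_; _<_; _⊓_; _⊔_; ∣_-_∣; z≤n; s≤s; s≤s⁻¹; _≤?_; _<?_; >-nonZero)
open import Data.Nat.Properties
open import Algebra.Properties.CommutativeMonoid.Sum +-0-commutativeMonoid
  using (sum; sum-syntax; ∑-comm; sum-cong-≗; sum-replicate-zero; sum-init-last)
open import Data.Nat.Solver using (module +-*-Solver)
open +-*-Solver using (solve; _:+_; _:=_)
open import Data.Product using (_,_; ∃; proj₁; proj₂)
import Data.Product as Product
open import Data.Sum using (_⊎_; inj₁; inj₂)
import Data.Sum as Sum
open import Data.Vec.Functional using (updateAt)
import Data.Vec.Functional as Vector
open import Data.Vec.Functional.Properties using (updateAt-updates; updateAt-minimal)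
open import Function using (_∘_)
open import Relation.Nullary using (¬_; Dec; yes; no)
open import Relation.Nullary.Decidable using (_×-dec_)
open import Relation.Binary.PropositionalEquality
  using (refl; sym; trans; cong; cong₂; subst; module ≡-Reasoning)

private
  variable
    A B C : Set
    m n : ℕ

foldr-map-tabulate : (c : B → C → C) (z : C) (h : A → B) (g : Fin n → A) →
  List.foldr c z (map h (tabulate g)) ≡ Vector.foldr c z (h ∘ g)
foldr-map-tabulate {n = zero}  c z h g = refl
foldr-map-tabulate {n = suc n} c z h g = cong (c (h (g zero))) (foldr-map-tabulate c z h (g ∘ suc))

∑-mono-≤ : {f g : Fin n → ℕ} → (∀ i → f i ≤ g i) → sum f ≤ sum g
∑-mono-≤ {zero}  f≤g = z≤n
∑-mono-≤ {suc n} f≤g = +-mono-≤ (f≤g zero) (∑-mono-≤ (f≤g ∘ suc))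

∑-one : ∀ n → ∑[ i < n ] 1 ≡ n
∑-one zero    = refl
∑-one (suc n) = cong suc (∑-one n)

∑-toℕ-suc : (g : ℕ → ℕ) → ∑[ e < suc n ] g (toℕ e) ≡ ∑[ e < n ] g (toℕ e) + g n
∑-toℕ-suc {n} g = begin
  ∑[ e < suc n ] g (toℕ e)                            ≡⟨ sum-init-last (g ∘ toℕ) ⟩
  ∑[ e < n ] g (toℕ (inject₁ e)) + g (toℕ (fromℕ n)) ≡⟨ cong₂ _+_ (sum-cong-≗ {n} (cong g ∘ toℕ-inject₁))
                                                                  (cong g (toℕ-fromℕ n)) ⟩
  ∑[ e < n ] g (toℕ e) + g n                          ∎
  where open ≡-Reasoning

∑≤1 : (h : Fin n → ℕ) → (∀ i → h i ≤ 1) → (∀ i j → 0 < h i → 0 < h j → i ≡ j) → sum h ≤ 1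
∑≤1 {zero}  h h≤1 unique = z≤n
∑≤1 {suc n} h h≤1 unique with 0 <? h zero
... | no  h₀≯0 = ≤-trans (≤-reflexive (cong (_+ sum (h ∘ suc)) (n≤0⇒n≡0 (≮⇒≥ h₀≯0))))
                         (∑≤1 (h ∘ suc) (h≤1 ∘ suc) λ i j p q → Fin.suc-injective (unique (suc i) (suc j) p q))
... | yes h₀>0 = ≤-trans (≤-reflexive (trans (cong (h zero +_) tail≡0) (+-identityʳ (h zero)))) (h≤1 zero)
  where
  tail≡0 : sum (h ∘ suc) ≡ 0
  tail≡0 = trans (sum-cong-≗ rest≡0) (sum-replicate-zero n)
    where
    rest≡0 : ∀ i → h (suc i) ≡ 0
    rest≡0 i with 0 <? h (suc i)
    ... | yes hᵢ>0 with () ← unique zero (suc i) h₀>0 hᵢ>0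
    ... | no  hᵢ≯0 = n≤0⇒n≡0 (≮⇒≥ hᵢ≯0)

χ[_,_⟩ : ℕ → ℕ → ℕ → ℕ
χ[ lo , hi ⟩ e with lo ≤? e | e <? hi
... | yes _ | yes _ = 1
... | _     | _     = 0

χ≤1 : ∀ lo hi e → χ[ lo , hi ⟩ e ≤ 1
χ≤1 lo hi e with lo ≤? e | e <? hi
... | yes _ | yes _ = ≤-refl
... | yes _ | no  _ = z≤n
... | no  _ | _     = z≤n

χ>0⇒∈ : ∀ lo hi e → 0 < χ[ lo , hi ⟩ e → lo ≤ e × e < hi
χ>0⇒∈ lo hi e χ>0 with lo ≤? e | e <? hi
... | yes lo≤e | yes e<hi = lo≤e , e<hi

∑χ : ∀ n lo hi → ∑[ e < n ] χ[ lo , hi ⟩ (toℕ e) ≡ n ⊓ hi ∸ lo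
∑χ zero    lo hi = sym (0∸n≡0 lo)
∑χ (suc n) lo hi = trans (∑-toℕ-suc χ[ lo , hi ⟩) (trans (cong (_+ χ[ lo , hi ⟩ n) (∑χ n lo hi)) step)
  where
  step : n ⊓ hi ∸ lo + χ[ lo , hi ⟩ n ≡ suc n ⊓ hi ∸ lo
  step with lo ≤? n | n <? hi
  ... | yes lo≤n | yes n<hi
      rewrite m≤n⇒m⊓n≡m (<⇒≤ n<hi) | m≤n⇒m⊓n≡m n<hi = trans (+-comm _ 1) (sym (+-∸-assoc 1 lo≤n))
  ... | yes _ | no n≮hi
      rewrite m≥n⇒m⊓n≡n (≮⇒≥ n≮hi) | m≥n⇒m⊓n≡n (m≤n⇒m≤1+n (≮⇒≥ n≮hi)) = +-identityʳ _
  ... | no lo≰n | _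
      rewrite m≤n⇒m∸n≡0 (≤-trans (m⊓n≤m n hi) (<⇒≤ (≰⇒> lo≰n)))
            | m≤n⇒m∸n≡0 (≤-trans (m⊓n≤m (suc n) hi) (≰⇒> lo≰n)) = refl

disjoint-intervals-length≤ : ∀ N (lo hi : Fin m → ℕ) → (∀ v → hi v ≤ N) →
  (∀ v w e → lo v ≤ e → e < hi v → lo w ≤ e → e < hi w → v ≡ w) →
  ∑[ v < m ] (hi v ∸ lo v) ≤ N
disjoint-intervals-length≤ {m} N lo hi hi≤N disjoint = begin
  ∑[ v < m ] (hi v ∸ lo v)          ≡⟨ sum-cong-≗ {m} length≡count ⟩
  ∑[ v < m ] ∑[ e < N ] χ v (toℕ e) ≡⟨ ∑-comm {m} {N} (λ v e → χ v (toℕ e)) ⟩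
  ∑[ e < N ] ∑[ v < m ] χ v (toℕ e) ≤⟨ ∑-mono-≤ {N} (λ e → ∑≤1 _ (λ _ → χ≤1 _ _ _) (unique (toℕ e))) ⟩
  ∑[ e < N ] 1                      ≡⟨ ∑-one N ⟩
  N                                 ∎
  where
  open ≤-Reasoning
  χ : Fin m → ℕ → ℕ
  χ v = χ[ lo v , hi v ⟩
  length≡count : ∀ v → hi v ∸ lo v ≡ ∑[ e < N ] χ v (toℕ e)
  length≡count v = sym (trans (∑χ N (lo v) (hi v)) (cong (_∸ lo v) (m≥n⇒m⊓n≡n (hi≤N v))))
  unique : ∀ e v w → 0 < χ v e → 0 < χ w e → v ≡ w
  unique e v w χᵥ>0 χ𝓌>0 with χ>0⇒∈ _ _ e χᵥ>0 | χ>0⇒∈ _ _ e χ𝓌>0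
  ... | lo≤e , e<hi | lo≤e′ , e<hi′ = disjoint v w e lo≤e e<hi lo≤e′ e<hi′

cost≡∑ : (f : Fin n → ℕ) → cost f ≡ sum f
cost≡∑ f = foldr-map-tabulate _+_ 0 f (λ i → i)

≤-maxList-allFin : (h : Fin n → ℕ) (i : Fin n) → h i ≤ maxList (map h (allFin n))
≤-maxList-allFin h i = subst (h i ≤_) (sym (foldr-map-tabulate _⊔_ 0 h (λ j → j))) (≤-foldr h i)
  where
  ≤-foldr : ∀ {n} (h : Fin n → ℕ) i → h i ≤ Vector.foldr _⊔_ 0 h
  ≤-foldr h zero    = m≤m⊔n _ _
  ≤-foldr h (suc i) = ≤-trans (≤-foldr (h ∘ suc) i) (m≤n⊔m _ _)

maxList-allFin-≤ : {h : Fin n → ℕ} {b : ℕ} → (∀ i → h i ≤ b) → maxList (map h (allFin n)) ≤ b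
maxList-allFin-≤ {h = h} h≤b = subst (_≤ _) (sym (foldr-map-tabulate _⊔_ 0 h (λ j → j))) (foldr-≤ h≤b)
  where
  foldr-≤ : ∀ {n} {h : Fin n → ℕ} {b} → (∀ i → h i ≤ b) → Vector.foldr _⊔_ 0 h ≤ b
  foldr-≤ {zero}  h≤b = z≤n
  foldr-≤ {suc n} h≤b = ⊔-lub (h≤b zero) (foldr-≤ (h≤b ∘ suc))

∣-∣-between : ∀ {l x h} → l ≤ x → x ≤ h → ∣ l - x ∣ + ∣ x - h ∣ ≡ ∣ l - h ∣
∣-∣-between {x = x} z≤n x≤h = trans (cong (x +_) (m≤n⇒∣m-n∣≡n∸m x≤h)) (m+[n∸m]≡n x≤h)
∣-∣-between (s≤s l≤x) (s≤s x≤h) = ∣-∣-between l≤x x≤h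

∣-∣-via : ∀ m n {x} → m ⊓ n ≤ x → x ≤ m ⊔ n → ∣ m - x ∣ + ∣ x - n ∣ ≡ ∣ m - n ∣
∣-∣-via m n {x} lo≤x x≤hi with ≤-total m n
... | inj₁ m≤n rewrite m≤n⇒m⊓n≡m m≤n | m≤n⇒m⊔n≡n m≤n = ∣-∣-between lo≤x x≤hi
... | inj₂ n≤m rewrite m≥n⇒m⊓n≡n n≤m | m≥n⇒m⊔n≡m n≤m = begin
  ∣ m - x ∣ + ∣ x - n ∣ ≡⟨ +-comm ∣ m - x ∣ ∣ x - n ∣ ⟩
  ∣ x - n ∣ + ∣ m - x ∣ ≡⟨ cong₂ _+_ (∣-∣-comm x n) (∣-∣-comm m x) ⟩
  ∣ n - x ∣ + ∣ x - m ∣ ≡⟨ ∣-∣-between lo≤x x≤hi ⟩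
  ∣ n - m ∣             ≡⟨ ∣-∣-comm n m ⟩
  ∣ m - n ∣             ∎
  where open ≡-Reasoning

∣n-1+n∣≡1 : ∀ n → ∣ n - suc n ∣ ≡ 1
∣n-1+n∣≡1 zero    = refl
∣n-1+n∣≡1 (suc n) = ∣n-1+n∣≡1 n

∣m-n∣≡m⊔n∸m⊓n : ∀ m n → ∣ m - n ∣ ≡ m ⊔ n ∸ m ⊓ n
∣m-n∣≡m⊔n∸m⊓n m n with ≤-total m n
... | inj₁ m≤n rewrite m≤n⇒m⊓n≡m m≤n | m≤n⇒m⊔n≡n m≤n = m≤n⇒∣m-n∣≡n∸m m≤n
... | inj₂ n≤m rewrite m≥n⇒m⊓n≡n n≤m | m≥n⇒m⊔n≡m n≤m = trans (∣-∣-comm m n) (m≤n⇒∣m-n∣≡n∸m n≤m)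

-- If x lies on geodesics from p to v and from q to w of lengths a and b, then p is within b of w or
-- q is within a of v: otherwise the two detours through x would be longer than the geodesics themselves.
geodesics-cross : ∀ {p q v w x a b} → ∣ p - x ∣ + ∣ x - v ∣ ≤ a → ∣ q - x ∣ + ∣ x - w ∣ ≤ b →
  b < ∣ p - w ∣ → a < ∣ q - v ∣ → ⊥
geodesics-cross {p} {q} {v} {w} {x} {a} {b} px+xv≤a qx+xw≤b b<pw a<qv = <-irrefl refl (begin-strict
  a + b                                             <⟨ +-mono-< a<qv b<pw ⟩
  ∣ q - v ∣ + ∣ p - w ∣                             ≤⟨ +-mono-≤ (∣-∣-triangle q x v) (∣-∣-triangle p x w) ⟩
  (∣ q - x ∣ + ∣ x - v ∣) + (∣ p - x ∣ + ∣ x - w ∣) ≡⟨ swap ∣ q - x ∣ ∣ x - v ∣ ∣ p - x ∣ ∣ x - w ∣ ⟩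
  (∣ p - x ∣ + ∣ x - v ∣) + (∣ q - x ∣ + ∣ x - w ∣) ≤⟨ +-mono-≤ px+xv≤a qx+xw≤b ⟩
  a + b                                             ∎)
  where
  open ≤-Reasoning
  swap : ∀ i j k l → (i + j) + (k + l) ≡ (k + j) + (i + l)
  swap = solve 4 (λ i j k l → (i :+ j) :+ (k :+ l) := (k :+ j) :+ (i :+ l)) refl

module _ {n : ℕ} (d : Dist n) where

  -- A weakening of PB_f(v) ≠ ∅ shared by irredundant and minimal dominating broadcasts.
  PrivateWitness : (Fin n → ℕ) → Fin n → Set
  PrivateWitness f v = ∃ λ u → InPN d f v u × (d u v ≡ f v ⊎ (f v ≡ 1 × u ≡ v))

  irredundant⇒privateWitness : ∀ {f v} → IsIrredundant d f → 0 < f v → PrivateWitness f v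
  irredundant⇒privateWitness {v = v} (_ , border) v>0 with border v v>0
  ... | _ , inj₁ ((fv≡1 , PN≡｛v｝) , refl) = v , proj₂ (PN≡｛v｝ v) refl , inj₂ (fv≡1 , refl)
  ... | u , inj₂ (_ , u∈PN , duv≡fv)       = u , u∈PN , inj₁ duv≡fv

  hears? : ∀ f u w → Dec (Hears d f u w)
  hears? f u w = (0 <? f w) ×-dec (d u w ≤? f w)

  decrease : (Fin n → ℕ) → Fin n → Fin n → ℕ
  decrease f v = updateAt f v pred

  decrease-≤ : ∀ f v w → decrease f v w ≤ f w
  decrease-≤ f v w with w Fin.≟ v
  ... | yes refl = ≤-trans (≤-reflexive (updateAt-updates v f)) pred[n]≤n
  ... | no  w≢v  = ≤-reflexive (updateAt-minimal w v f w≢v)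

  minimal⇒undominated : ∀ {f v} → IsMinimalDom d f → 0 < f v → ∃ λ u → ¬ ∃ (Hears d (decrease f v) u)
  minimal⇒undominated {f} {v} ((broadcast , _) , minimal) v>0 =
    ¬∀⟶∃¬ n _ (λ u → any? (hears? (decrease f v) u)) not-dominating
    where
    not-dominating : ¬ IsDominating d (decrease f v)
    not-dominating dominating = <-irrefl (trans (sym (updateAt-updates v f)) unchanged) pred[fv]<fv
      where
      unchanged : decrease f v v ≡ f v
      unchanged = minimal (decrease f v)
        ((λ w → ≤-trans (decrease-≤ f v w) (broadcast w)) , dominating) (decrease-≤ f v) v
      pred[fv]<fv : pred (f v) < f v
      pred[fv]<fv = ≤-reflexive (suc-pred (f v) {{>-nonZero v>0}})

  undominated⇒heard-only-by : ∀ {f v u w} → ¬ ∃ (Hears d (decrease f v) u) → Hears d f u w → w ≡ v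
  undominated⇒heard-only-by {f} {v} {u} {w} undominated hears with w Fin.≟ v
  ... | yes w≡v = w≡v
  ... | no  w≢v = ⊥-elim (undominated (w ,
          subst (λ r → 0 < r × d u w ≤ r) (sym (updateAt-minimal w v f w≢v)) hears))

  undominated⇒on-border : ∀ {f v u} → Hears d f u v → ¬ ∃ (Hears d (decrease f v) u) →
    d u v ≡ f v ⊎ (f v ≡ 1 × d u v ≡ 0)
  undominated⇒on-border {f} {v} {u} (v>0 , duv≤fv) undominated with m≤n⇒m<n∨m≡n duv≤fv
  ... | inj₂ duv≡fv = inj₁ duv≡fv
  ... | inj₁ duv<fv with 1 <? f v
  ...   | yes fv>1 = ⊥-elim (undominated (v ,
            subst (λ r → 0 < r × d u v ≤ r) (sym (updateAt-updates v f)) (<⇒≤pred fv>1 , <⇒≤pred duv<fv)))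
  ...   | no  fv≯1 = inj₂ (fv≡1 , n<1⇒n≡0 (subst (d u v <_) fv≡1 duv<fv))
    where
    fv≡1 : f v ≡ 1
    fv≡1 = ≤-antisym (≮⇒≥ fv≯1) v>0

  minimalDom⇒privateWitness : (∀ {u w} → d u w ≡ 0 → u ≡ w) →
    ∀ {f v} → IsMinimalDom d f → 0 < f v → PrivateWitness f v
  minimalDom⇒privateWitness separated {f} {v} minimal@((_ , dominating) , _) v>0
    with minimal⇒undominated minimal v>0
  ... | u , undominated =
    u , (u-hears-v , λ _ → only-v) ,
    Sum.map₂ (Product.map₂ separated) (undominated⇒on-border u-hears-v undominated)
    where
    only-v : ∀ {w} → Hears d f u w → w ≡ v
    only-v = undominated⇒heard-only-by undominated
    u-hears-v : Hears d f u v
    u-hears-v = subst (Hears d f u) (only-v (proj₂ (dominating u))) (proj₂ (dominating u))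

pathDist-separates : ∀ {n} {u w : Fin n} → pathDist n u w ≡ 0 → u ≡ w
pathDist-separates = Fin.toℕ-injective ∘ ∣m-n∣≡0⇒m≡n

module Path (k : ℕ) where

  N : ℕ
  N = suc k

  private
    d : Dist (suc N)
    d = pathDist (suc N)

  Endpoint : ℕ → ℕ → Set
  Endpoint e x = x ≡ e ⊎ x ≡ suc e

  endpoints-adjacent : ∀ {e x y} → Endpoint e x → Endpoint e y → ∣ x - y ∣ ≤ 1
  endpoints-adjacent {e} (inj₁ refl) (inj₁ refl) = ≤-trans (≤-reflexive (∣n-n∣≡0 e)) z≤n
  endpoints-adjacent {e} (inj₁ refl) (inj₂ refl) = ≤-reflexive (∣n-1+n∣≡1 e)
  endpoints-adjacent {e} (inj₂ refl) (inj₁ refl) = ≤-reflexive (trans (∣-∣-comm (suc e) e) (∣n-1+n∣≡1 e))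
  endpoints-adjacent {e} (inj₂ refl) (inj₂ refl) = ≤-trans (≤-reflexive (∣n-n∣≡0 (suc e))) z≤n

  -- Edge e = {e, e+1} is charged to the broadcasting vertex v: either it lies on a geodesic from v
  -- to a private neighbour p at distance f v, or f v = 1, v is its own private neighbour and e is
  -- incident to v.
  data Covers (f : Fin (suc N) → ℕ) (v : Fin (suc N)) (e : ℕ) : Set where
    geodesic : ∀ p → InPN d f v p →
      ∣ toℕ p - e ∣ + ∣ e - toℕ v ∣ ≤ f v → ∣ toℕ p - suc e ∣ + ∣ suc e - toℕ v ∣ ≤ f v → Covers f v e
    loop : InPN d f v v → f v ≡ 1 → Endpoint e (toℕ v) → Covers f v e

  covers⇒within : ∀ {f v e x} → Covers f v e → Endpoint e x → ∣ x - toℕ v ∣ ≤ f v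
  covers⇒within (geodesic _ _ pe+ev≤fv _) (inj₁ refl) = ≤-trans (m≤n+m _ _) pe+ev≤fv
  covers⇒within (geodesic _ _ _ pe+ev≤fv) (inj₂ refl) = ≤-trans (m≤n+m _ _) pe+ev≤fv
  covers⇒within (loop _ fv≡1 v∈e) x∈e = ≤-trans (endpoints-adjacent x∈e v∈e) (≤-reflexive (sym fv≡1))

  hears-covering : ∀ {f v e u} → Covers f v e → Endpoint e (toℕ u) → Hears d f u v
  hears-covering c@(geodesic _ ((v>0 , _) , _) _ _) u∈e = v>0 , covers⇒within c u∈e
  hears-covering c@(loop ((v>0 , _) , _) _ _)     u∈e = v>0 , covers⇒within c u∈e

  covers-unique : ∀ {f v w e} → Covers f v e → Covers f w e → v ≡ w
  covers-unique {w = w} (loop (_ , only-v) _ v∈e) w-covers = sym (only-v w (hears-covering w-covers v∈e))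
  covers-unique {v = v} v-covers (loop (_ , only-w) _ w∈e) = only-w v (hears-covering v-covers w∈e)
  covers-unique {f} {v} {w} {e} (geodesic p p∈PN[v] pe+ev≤fv _) (geodesic q q∈PN[w] qe+ew≤fw _)
    with ∣ toℕ p - toℕ w ∣ ≤? f w | ∣ toℕ q - toℕ v ∣ ≤? f v
  ... | yes pw≤fw | _         = sym (proj₂ p∈PN[v] w (proj₁ (proj₁ q∈PN[w]) , pw≤fw))
  ... | no  _     | yes qv≤fv = proj₂ q∈PN[w] v (proj₁ (proj₁ p∈PN[v]) , qv≤fv)
  ... | no  pw≰fw | no  qv≰fv = ⊥-elim (geodesics-cross {toℕ p} {toℕ q} {toℕ v} {toℕ w} {e}
                                   pe+ev≤fv qe+ew≤fw (≰⇒> pw≰fw) (≰⇒> qv≰fv))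

  record Segment (f : Fin (suc N) → ℕ) (v : Fin (suc N)) : Set where
    field
      lo hi  : ℕ
      hi≤N   : hi ≤ N
      length : hi ∸ lo ≡ f v
      covers : ∀ e → lo ≤ e → e < hi → Covers f v e

  geodesicSegment : ∀ {f v} u → InPN d f v u → ∣ toℕ u - toℕ v ∣ ≡ f v → Segment f v
  geodesicSegment {f} {v} u u∈PN duv≡fv = record
    { lo     = toℕ u ⊓ toℕ v
    ; hi     = toℕ u ⊔ toℕ v
    ; hi≤N   = ⊔-lub (toℕ≤pred[n] u) (toℕ≤pred[n] v)
    ; length = trans (sym (∣m-n∣≡m⊔n∸m⊓n (toℕ u) (toℕ v))) duv≡fv
    ; covers = λ e lo≤e e<hi → geodesic u u∈PN
        (≤-reflexive (trans (∣-∣-via (toℕ u) (toℕ v) {e} lo≤e (<⇒≤ e<hi)) duv≡fv))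
        (≤-reflexive (trans (∣-∣-via (toℕ u) (toℕ v) {suc e} (m≤n⇒m≤1+n lo≤e) e<hi) duv≡fv))
    }

  loopSegment : ∀ {f} v → InPN d f v v → f v ≡ 1 → Segment f v
  loopSegment {f} v v∈PN fv≡1 = record
    { lo     = pred (toℕ v)
    ; hi     = suc (pred (toℕ v))
    ; hi≤N   = suc-pred≤N (toℕ v) (toℕ≤pred[n] v)
    ; length = trans (m+n∸n≡m 1 (pred (toℕ v))) (sym fv≡1)
    ; covers = λ e lo≤e e<hi → loop v∈PN fv≡1
        (subst (λ e → Endpoint e (toℕ v)) (≤-antisym lo≤e (s≤s⁻¹ e<hi)) (endpoint-pred (toℕ v)))
    }
    where
    endpoint-pred : ∀ x → Endpoint (pred x) x
    endpoint-pred zero    = inj₁ refl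
    endpoint-pred (suc x) = inj₂ refl
    suc-pred≤N : ∀ x → x ≤ N → suc (pred x) ≤ N
    suc-pred≤N zero    _   = s≤s z≤n
    suc-pred≤N (suc x) x≤N = x≤N

  segment : ∀ {f v} → (0 < f v → PrivateWitness d f v) → Segment f v
  segment {f} {v} witness with 0 <? f v
  ... | no  v≯0 =
    record { lo = 0 ; hi = 0 ; hi≤N = z≤n ; length = sym (n≤0⇒n≡0 (≮⇒≥ v≯0)) ; covers = λ _ _ () }
  ... | yes v>0 with witness v>0
  ...   | u , u∈PN , inj₁ duv≡fv         = geodesicSegment u u∈PN duv≡fv
  ...   | _ , v∈PN , inj₂ (fv≡1 , refl) = loopSegment v v∈PN fv≡1

  privateWitnesses⇒cost≤N : ∀ {f} → (∀ v → 0 < f v → PrivateWitness d f v) → cost f ≤ N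
  privateWitnesses⇒cost≤N {f} witness = begin
    cost f                               ≡⟨ cost≡∑ f ⟩
    ∑[ v < suc N ] f v                   ≡⟨ sum-cong-≗ {suc N} (λ v → sym (length (segments v))) ⟩
    ∑[ v < suc N ] (hi (segments v) ∸ lo (segments v))
      ≤⟨ disjoint-intervals-length≤ N (lo ∘ segments) (hi ∘ segments) (hi≤N ∘ segments) disjoint ⟩
    N                                    ∎
    where
    open ≤-Reasoning
    open Segment
    segments : ∀ v → Segment f v
    segments v = segment (witness v)
    disjoint : ∀ v w e → lo (segments v) ≤ e → e < hi (segments v) →
                         lo (segments w) ≤ e → e < hi (segments w) → v ≡ w
    disjoint v w e lo≤e e<hi lo′≤e e<hi′ =
      covers-unique (covers (segments v) e lo≤e e<hi) (covers (segments w) e lo′≤e e<hi′)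

  last : Fin (suc N)
  last = fromℕ N

  d[last,zero]≡N : d last zero ≡ N
  d[last,zero]≡N = trans (∣-∣-comm (toℕ last) 0) (toℕ-fromℕ N)

  ecc≤N : ∀ v → ecc d v ≤ N
  ecc≤N v = maxList-allFin-≤ λ u → ≤-trans (∣m-n∣≤m⊔n (toℕ v) (toℕ u)) (⊔-lub (toℕ≤pred[n] v) (toℕ≤pred[n] u))

  N≤ecc[zero] : N ≤ ecc d zero
  N≤ecc[zero] = subst (_≤ ecc d zero) (toℕ-fromℕ N) (≤-maxList-allFin (d zero) last)

  diam≡N : diam d ≡ N
  diam≡N = ≤-antisym (maxList-allFin-≤ ecc≤N) (≤-trans N≤ecc[zero] (≤-maxList-allFin (ecc d) zero))

  endBroadcast : Fin (suc N) → ℕ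
  endBroadcast zero    = N
  endBroadcast (suc _) = 0

  endBroadcast-cost : cost endBroadcast ≡ N
  endBroadcast-cost = trans (cost≡∑ endBroadcast) (trans (cong (N +_) (sum-replicate-zero N)) (+-identityʳ N))

  endBroadcast-isBroadcast : IsBroadcast d endBroadcast
  endBroadcast-isBroadcast zero    = N≤ecc[zero]
  endBroadcast-isBroadcast (suc _) = z≤n

  hears-endBroadcast⇒zero : ∀ {u w} → Hears d endBroadcast u w → w ≡ zero
  hears-endBroadcast⇒zero {w = zero} _ = refl

  endBroadcast-minimalDom : IsMinimalDom d endBroadcast
  endBroadcast-minimalDom = (endBroadcast-isBroadcast , everyone-hears-zero) , nothing-below
    where
    everyone-hears-zero : IsDominating d endBroadcast
    everyone-hears-zero u = zero , s≤s z≤n , ≤-trans (≤-reflexive (∣-∣-comm (toℕ u) 0)) (toℕ≤pred[n] u)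
    nothing-below : ∀ g → IsDomBroadcast d g → (∀ u → g u ≤ endBroadcast u) → ∀ u → g u ≡ endBroadcast u
    nothing-below g _ g≤ (suc u) = n≤0⇒n≡0 (g≤ (suc u))
    nothing-below g (_ , dominating) g≤ zero with dominating last
    ... | zero  , _   , d≤g₀ = ≤-antisym (g≤ zero) (subst (_≤ g zero) d[last,zero]≡N d≤g₀)
    ... | suc w , w>0 , _    = ⊥-elim (<⇒≱ w>0 (g≤ (suc w)))

  last∈PN[zero] : InPN d endBroadcast zero last
  last∈PN[zero] = (s≤s z≤n , ≤-reflexive d[last,zero]≡N) , λ _ → hears-endBroadcast⇒zero {last}

  endBroadcast-irredundant : IsIrredundant d endBroadcast
  endBroadcast-irredundant = endBroadcast-isBroadcast , border
    where
    border : ∀ v → 0 < endBroadcast v → ∃ (InPB d endBroadcast v)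
    border zero _ = last , inj₂ (not-special , last∈PN[zero] , d[last,zero]≡N)
      where
      not-special : ¬ PBSpecial d endBroadcast zero
      not-special (_ , PN≡｛zero｝) = Fin.0≢1+n (sym (proj₁ (PN≡｛zero｝ last) last∈PN[zero]))

theorem3p1 : (n : ℕ) → 2 ≤ n →
    UpperBroadcastDom (pathDist n) (n ∸ 1) ×
    UpperBroadcastIrr (pathDist n) (n ∸ 1) ×
    diam (pathDist n) ≡ n ∸ 1
theorem3p1 (suc (suc k)) (s≤s (s≤s z≤n)) =
    ( (endBroadcast , endBroadcast-minimalDom , endBroadcast-cost)
    , λ _ minimal → privateWitnesses⇒cost≤N λ _ →
        minimalDom⇒privateWitness (pathDist (suc N)) pathDist-separates minimal )
  , ( (endBroadcast , endBroadcast-irredundant , endBroadcast-cost)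
    , λ _ irredundant → privateWitnesses⇒cost≤N λ _ →
        irredundant⇒privateWitness (pathDist (suc N)) irredundant )
  , diam≡N
  where open Path k
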